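{- For every integer $m$ and every positive integer $n$, \[ \sum_{ \pi \in \mathcal{D}(n) } (-1)^{ \mathrm{rank}(\pi)+s(\pi)-1 } \sum_{j=1}^{s(\pi)} (-1)^j \big(\ell(\pi)-s(\pi) + j\big)^m = \sum_{d | n} (-1)^d d^m, \] where the sum on the right is over the positive divisors $d$ of $n$.
   Context: $\mathcal{D}(n)$ denotes the set of partitions of $n$ into distinct parts. For a partition $\pi$, $s(\pi)$ is its smallest part, $\ell(\pi)$ its largest part, $\#(\pi)$ its number of parts, and $\mathrm{rank}(\pi)=\ell(\pi)-\#(\pi)$. -}

module Defs where

open import Data.Nat as ℕ using (ℕ; zero; suc; _∸_)
open import Data.Nat.Divisibility using (_∣?_)
open import Data.Nat.ListAction using (sum)
open import Data.Nat.Properties using (m^n≢0)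
open import Data.Integer as ℤ using (ℤ; +_; -[1+_]; ∣_∣)
open import Data.Rational as ℚ using (ℚ; 0ℚ; 1ℚ; _/_)
open import Data.List using (List; []; _∷_; length; map; filter; applyUpTo; _++_; foldr)
import Data.List as L
open import Data.Bool using (if_then_else_)
open import Relation.Nullary.Decidable using (does)
open import Data.Nat.Properties using (_≟_)

sumℚ : List ℚ → ℚ
sumℚ = foldr ℚ._+_ 0ℚ

sublists : List ℕ → List (List ℕ)
sublists []       = [] ∷ []
sublists (x ∷ xs) = map (x ∷_) (sublists xs) ++ sublists xs

downFrom1 : ℕ → List ℕ
downFrom1 zero    = []
downFrom1 (suc n) = suc n ∷ downFrom1 n

-- 𝒟(n): partitions of n into distinct parts, each represented once as the
-- strictly decreasing list of its parts (a subset of {1,…,n} with sum n).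
𝒟 : ℕ → List (List ℕ)
𝒟 n = filter (λ π → sum π ≟ n) (sublists (downFrom1 n))

-- largest part ℓ(π) (head of decreasing list); 0 for the empty partition
largest : List ℕ → ℕ
largest []      = 0
largest (x ∷ _) = x

-- smallest part s(π) (last element); 0 for the empty partition
smallest : List ℕ → ℕ
smallest []           = 0
smallest (x ∷ [])     = x
smallest (_ ∷ y ∷ ys) = smallest (y ∷ ys)

numParts : List ℕ → ℕ
numParts = length

rank : List ℕ → ℤ
rank π = + largest π ℤ.- + numParts π

signℚ : ℤ → ℚ
signℚ k = if does (∣ k ∣ ℕ.% 2 ≟ 0) then 1ℚ else ℚ.- 1ℚ

-- b^m for a natural base b and an integer exponent m, as a rational.
-- (For negative m and b = 0 the value is a junk 0; never used, bases are ≥ 1.)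
powℤ : ℕ → ℤ → ℚ
powℤ b (+ k)          = + (b ℕ.^ k) / 1
powℤ zero -[1+ k ]    = 0ℚ
powℤ (suc b) -[1+ k ] = (+ 1 / (suc b ℕ.^ suc k)) {{m^n≢0 (suc b) (suc k)}}

sumFrom1 : ℕ → (ℕ → ℚ) → ℚ
sumFrom1 s f = sumℚ (applyUpTo (λ i → f (suc i)) s)

divisors : ℕ → List ℕ
divisors n = filter (λ d → d ∣? n) (applyUpTo suc n)

lhsTerm : ℤ → List ℕ → ℚ
lhsTerm m π =
  signℚ (rank π ℤ.+ + smallest π ℤ.- + 1) ℚ.*
  sumFrom1 (smallest π) (λ j → signℚ (+ j) ℚ.* powℤ ((largest π ∸ smallest π) ℕ.+ j) m)

rhsTerm : ℤ → ℕ → ℚ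
rhsTerm m d = signℚ (+ d) ℚ.* powℤ d m

{-# OPTIONS --safe #-}
module Submission where

-- Write a partition as ℓ ∷ S with smallest part s, and put a = ℓ − s. Since (−1)^j = (−1)^a (−1)^(a+j),
-- its inner sum is (−1)^a ∑_{d=a+1}^{ℓ} (−1)^d d^m, while its sign (−1)^(rank + s − 1) is (−1)^(a + #S).
-- So the left side is ∑_d (−1)^d d^m c_d, where c_d sums (−1)^#S over the partitions of n into distinct
-- parts lying in a window (ℓ − d, ℓ] with ℓ ≥ d. Putting ℓ = c + d, c_d is the coefficient of q^(n−d) in
-- ∑_{c≥0} q^c (1 − q^(c+1)) ⋯ (1 − q^(c+d−1)), a telescoping series equal to 1/(1 − q^d); so c_d = [d ∣ n].

open import Defs
open import Data.Bool using (true; false; if_then_else_)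
open import Data.Integer as ℤ using (ℤ; +_; _⊖_)
import Data.Integer.Properties as ℤ
import Data.Integer.Solver as ℤ-Solver
open import Data.List using (List; []; _∷_; [_]; _++_; map; filter; length; applyUpTo)
import Data.List.Properties as List
open import Data.List.Relation.Unary.All as All using (All; []; _∷_; all?)
import Data.List.Relation.Unary.All.Properties as All
open import Data.Nat as ℕ using (ℕ; zero; suc; NonZero; _≤_; _<_; z≤n; s≤s; _∸_)
import Data.Nat.Properties as ℕ
open import Data.Nat.Divisibility using (_∣_; _∣?_; ∣-refl; ∣m∸n∣n⇒∣m; ∣m+n∣m⇒∣n; m%n≡0⇔n∣m)
open import Data.Nat.DivMod using (_%_; _/_; m≡m%n+[m/n]*n; m%n<n)
open import Data.Nat.ListAction using (sum)
open import Data.Product using (_×_; _,_; proj₁; proj₂)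
open import Data.Rational as ℚ using (ℚ; 0ℚ; 1ℚ; _+_; _*_; -_; _-_)
import Data.Rational.Properties as ℚ
open import Data.Rational.Solver using (module +-*-Solver)
open import Data.Unit using (⊤; tt)
open import Function.Bundles using (_⇔_; mk⇔; Equivalence)
open import Relation.Binary.PropositionalEquality using (_≡_; _≢_; refl; sym; trans; cong; cong₂; subst; module ≡-Reasoning)
open import Relation.Nullary using (Dec; does; ¬_)
open import Relation.Nullary.Decidable using (dec-true; dec-false; does-⇔)
open import Relation.Unary using (Pred; Decidable)

open +-*-Solver
open ℤ-Solver.+-*-Solver using () renaming (solve to solveℤ; _:+_ to _⊕_; _:-_ to _⊝_; _:=_ to _≐_)

+-interchange : ∀ a b c d → (a + b) + (c + d) ≡ (a + c) + (b + d)
+-interchange = solve 4 (λ a b c d → (a :+ b) :+ (c :+ d) := (a :+ c) :+ (b :+ d)) refl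

∑∈ : {A : Set} → (A → ℚ) → List A → ℚ
∑∈ f xs = sumℚ (map f xs)

infix 5 ∑∈
syntax ∑∈ (λ x → e) xs = ∑[ x ∈ xs ] e

module _ {A : Set} where

  ∑∈-++ : (f : A → ℚ) (xs ys : List A) → ∑∈ f (xs ++ ys) ≡ ∑∈ f xs + ∑∈ f ys
  ∑∈-++ f []       ys = sym (ℚ.+-identityˡ _)
  ∑∈-++ f (x ∷ xs) ys = trans (cong (_+_ (f x)) (∑∈-++ f xs ys)) (sym (ℚ.+-assoc (f x) _ _))

  ∑∈-map : {B : Set} (f : B → ℚ) (g : A → B) (xs : List A) → ∑∈ f (map g xs) ≡ ∑[ x ∈ xs ] f (g x)
  ∑∈-map f g []       = refl
  ∑∈-map f g (x ∷ xs) = cong (_+_ (f (g x))) (∑∈-map f g xs)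

  ∑∈-cong : {f g : A → ℚ} (xs : List A) → (∀ x → f x ≡ g x) → ∑∈ f xs ≡ ∑∈ g xs
  ∑∈-cong []       f≗g = refl
  ∑∈-cong (x ∷ xs) f≗g = cong₂ _+_ (f≗g x) (∑∈-cong xs f≗g)

  ∑∈-congᴬ : {P : A → Set} {f g : A → ℚ} {xs : List A} →
             All P xs → (∀ {x} → P x → f x ≡ g x) → ∑∈ f xs ≡ ∑∈ g xs
  ∑∈-congᴬ []         f≗g = refl
  ∑∈-congᴬ (px ∷ pxs) f≗g = cong₂ _+_ (f≗g px) (∑∈-congᴬ pxs f≗g)

  ∑∈-zero : (xs : List A) → ∑[ x ∈ xs ] 0ℚ ≡ 0ℚ
  ∑∈-zero []       = refl
  ∑∈-zero (x ∷ xs) = trans (ℚ.+-identityˡ _) (∑∈-zero xs)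

  ∑∈-neg : (f : A → ℚ) (xs : List A) → ∑[ x ∈ xs ] - f x ≡ - ∑∈ f xs
  ∑∈-neg f []       = refl
  ∑∈-neg f (x ∷ xs) = trans (cong (_+_ (- f x)) (∑∈-neg f xs)) (sym (ℚ.neg-distrib-+ (f x) _))

  ∑∈-distribˡ : (c : ℚ) (f : A → ℚ) (xs : List A) → ∑[ x ∈ xs ] c * f x ≡ c * ∑∈ f xs
  ∑∈-distribˡ c f []       = sym (ℚ.*-zeroʳ c)
  ∑∈-distribˡ c f (x ∷ xs) = trans (cong (_+_ (c * f x)) (∑∈-distribˡ c f xs)) (sym (ℚ.*-distribˡ-+ c (f x) _))

𝟙 : {P : Set} → Dec P → ℚ
𝟙 p? = if does p? then 1ℚ else 0ℚ

module _ {P : Set} (p? : Dec P) where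

  𝟙-yes : P → 𝟙 p? ≡ 1ℚ
  𝟙-yes p rewrite dec-true p? p = refl

  𝟙-no : ¬ P → 𝟙 p? ≡ 0ℚ
  𝟙-no ¬p rewrite dec-false p? ¬p = refl

  𝟙-yes-* : P → (x : ℚ) → 𝟙 p? * x ≡ x
  𝟙-yes-* p x = trans (cong (_* x) (𝟙-yes p)) (ℚ.*-identityˡ x)

  𝟙-no-* : ¬ P → (x : ℚ) → 𝟙 p? * x ≡ 0ℚ
  𝟙-no-* ¬p x = trans (cong (_* x) (𝟙-no ¬p)) (ℚ.*-zeroˡ x)

𝟙-⇔ : {P Q : Set} → P ⇔ Q → (p? : Dec P) (q? : Dec Q) → 𝟙 p? ≡ 𝟙 q?
𝟙-⇔ P⇔Q p? q? rewrite does-⇔ P⇔Q p? q? = refl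

∑∈-filter : {A : Set} {P : Pred A _} (P? : Decidable P) (f : A → ℚ) (xs : List A) →
            ∑∈ f (filter P? xs) ≡ ∑[ x ∈ xs ] 𝟙 (P? x) * f x
∑∈-filter P? f []       = refl
∑∈-filter P? f (x ∷ xs) with does (P? x)
... | true  = cong₂ _+_ (sym (ℚ.*-identityˡ (f x))) (∑∈-filter P? f xs)
... | false = trans (∑∈-filter P? f xs) (sym (trans (cong (_+ _) (ℚ.*-zeroˡ (f x))) (ℚ.+-identityˡ _)))

∑< : ℕ → (ℕ → ℚ) → ℚ
∑< zero    f = 0ℚ
∑< (suc n) f = ∑< n f + f n

infix 5 ∑<
syntax ∑< n (λ i → e) = ∑[ i < n ] e

∑<-cong : ∀ n {f g : ℕ → ℚ} → (∀ {i} → i < n → f i ≡ g i) → ∑< n f ≡ ∑< n g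
∑<-cong zero    f≗g = refl
∑<-cong (suc n) f≗g = cong₂ _+_ (∑<-cong n (λ i<n → f≗g (ℕ.m<n⇒m<1+n i<n))) (f≗g ℕ.≤-refl)

∑<-zero : ∀ n → ∑[ i < n ] 0ℚ ≡ 0ℚ
∑<-zero zero    = refl
∑<-zero (suc n) = trans (ℚ.+-identityʳ _) (∑<-zero n)

∑<-distribˡ : ∀ n (c : ℚ) (f : ℕ → ℚ) → ∑[ i < n ] c * f i ≡ c * ∑< n f
∑<-distribˡ zero    c f = sym (ℚ.*-zeroʳ c)
∑<-distribˡ (suc n) c f = trans (cong (_+ c * f n) (∑<-distribˡ n c f)) (sym (ℚ.*-distribˡ-+ c _ (f n)))

∑<-+ : ∀ n (f g : ℕ → ℚ) → ∑[ i < n ] (f i + g i) ≡ ∑< n f + ∑< n g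
∑<-+ zero    f g = sym (ℚ.+-identityˡ 0ℚ)
∑<-+ (suc n) f g = trans (cong (_+ (f n + g n)) (∑<-+ n f g)) (+-interchange (∑< n f) (∑< n g) (f n) (g n))

∑<-sub : ∀ n (f g : ℕ → ℚ) → ∑[ i < n ] (f i - g i) ≡ ∑< n f - ∑< n g
∑<-sub n f g = trans (∑<-+ n f (λ i → - g i)) (cong (_+_ (∑< n f)) (∑<-neg n))
  where
  ∑<-neg : ∀ n → ∑[ i < n ] - g i ≡ - ∑< n g
  ∑<-neg zero    = refl
  ∑<-neg (suc n) = trans (cong (_+ - g n) (∑<-neg n)) (sym (ℚ.neg-distrib-+ (∑< n g) (g n)))

∑<-comm : ∀ m n (f : ℕ → ℕ → ℚ) → ∑[ i < m ] ∑[ j < n ] f i j ≡ ∑[ j < n ] ∑[ i < m ] f i j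
∑<-comm zero    n f = sym (∑<-zero n)
∑<-comm (suc m) n f = trans (cong (_+ ∑< n (f m)) (∑<-comm m n f)) (sym (∑<-+ n _ (f m)))

∑∈-∑<-comm : {A : Set} (xs : List A) (n : ℕ) (f : A → ℕ → ℚ) →
             ∑[ x ∈ xs ] ∑[ j < n ] f x j ≡ ∑[ j < n ] ∑[ x ∈ xs ] f x j
∑∈-∑<-comm []       n f = sym (∑<-zero n)
∑∈-∑<-comm (x ∷ xs) n f = trans (cong (_+_ (∑< n (f x))) (∑∈-∑<-comm xs n f)) (sym (∑<-+ n (f x) _))

∑<-∑∈-∑<-factor : ∀ {A : Set} n (L : ℕ → List A) k (f : ℕ → ℚ) (g : ℕ → A → ℕ → ℚ) →
  ∑[ i < n ] ∑[ S ∈ L i ] ∑[ r < k ] f r * g i S r ≡ ∑[ r < k ] f r * (∑[ i < n ] ∑[ S ∈ L i ] g i S r)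
∑<-∑∈-∑<-factor n L k f g = begin
  ∑[ i < n ] ∑[ S ∈ L i ] ∑[ r < k ] f r * g i S r
    ≡⟨ ∑<-cong n (λ {i} _ → ∑∈-∑<-comm (L i) k _) ⟩
  ∑[ i < n ] ∑[ r < k ] ∑[ S ∈ L i ] f r * g i S r
    ≡⟨ ∑<-comm n k _ ⟩
  ∑[ r < k ] ∑[ i < n ] ∑[ S ∈ L i ] f r * g i S r
    ≡⟨ ∑<-cong k (λ {r} _ → trans (∑<-cong n (λ {i} _ → ∑∈-distribˡ (f r) _ (L i))) (∑<-distribˡ n (f r) _)) ⟩
  ∑[ r < k ] f r * (∑[ i < n ] ∑[ S ∈ L i ] g i S r) ∎
  where open ≡-Reasoning

∑<-suc : ∀ n (f : ℕ → ℚ) → ∑[ i < suc n ] f i ≡ f 0 + (∑[ i < n ] f (suc i))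
∑<-suc zero    f = ℚ.+-comm 0ℚ (f 0)
∑<-suc (suc n) f = trans (cong (_+ f (suc n)) (∑<-suc n f)) (ℚ.+-assoc (f 0) _ _)

∑<-telescope : ∀ n (f : ℕ → ℚ) → ∑[ i < n ] (f i - f (suc i)) ≡ f 0 - f n
∑<-telescope zero    f = sym (ℚ.+-inverseʳ (f 0))
∑<-telescope (suc n) f = trans (cong (_+ (f n - f (suc n))) (∑<-telescope n f)) (telescope (f 0) (f n) (f (suc n)))
  where
  telescope : ∀ a b c → (a - b) + (b - c) ≡ a - c
  telescope = solve 3 (λ a b c → (a :- b) :+ (b :- c) := a :- c) refl

sumℚ-applyUpTo : ∀ (f : ℕ → ℚ) n → sumℚ (applyUpTo f n) ≡ ∑< n f
sumℚ-applyUpTo f zero    = refl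
sumℚ-applyUpTo f (suc n) = trans (cong (_+_ (f 0)) (sumℚ-applyUpTo (λ i → f (suc i)) n)) (sym (∑<-suc n f))

∑<-restrict-< : ∀ b d (f : ℕ → ℚ) → ∑[ r < b ℕ.+ d ] 𝟙 (r ℕ.<? b) * f r ≡ ∑< b f
∑<-restrict-< b zero    f rewrite ℕ.+-identityʳ b = ∑<-cong b (λ {r} r<b → 𝟙-yes-* (r ℕ.<? b) r<b (f r))
∑<-restrict-< b (suc d) f rewrite ℕ.+-suc b d =
  trans (cong₂ _+_ (∑<-restrict-< b d f) (𝟙-no-* (b ℕ.+ d ℕ.<? b) (ℕ.≤⇒≯ (ℕ.m≤m+n b d)) _)) (ℚ.+-identityʳ _)

∑<-restrict-≥ : ∀ a s (f : ℕ → ℚ) → ∑[ i < a ℕ.+ s ] 𝟙 (a ℕ.≤? i) * f i ≡ ∑[ j < s ] f (a ℕ.+ j)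
∑<-restrict-≥ a zero    f rewrite ℕ.+-identityʳ a =
  trans (∑<-cong a (λ {i} i<a → 𝟙-no-* (a ℕ.≤? i) (ℕ.<⇒≱ i<a) (f i))) (∑<-zero a)
∑<-restrict-≥ a (suc s) f rewrite ℕ.+-suc a s =
  cong₂ _+_ (∑<-restrict-≥ a s f) (𝟙-yes-* (a ℕ.≤? a ℕ.+ s) (ℕ.m≤m+n a s) _)

sign : ℕ → ℚ
sign zero          = 1ℚ
sign (suc zero)    = - 1ℚ
sign (suc (suc n)) = sign n

sign-suc : ∀ n → sign (suc n) ≡ - sign n
sign-suc zero          = refl
sign-suc (suc zero)    = refl
sign-suc (suc (suc n)) = sign-suc n

sign-+ : ∀ a b → sign (a ℕ.+ b) ≡ sign a * sign b
sign-+ zero    b = sym (ℚ.*-identityˡ (sign b))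
sign-+ (suc a) b = begin
  sign (suc a ℕ.+ b)      ≡⟨ sign-suc (a ℕ.+ b) ⟩
  - sign (a ℕ.+ b)        ≡⟨ cong -_ (sign-+ a b) ⟩
  - (sign a * sign b)     ≡⟨ ℚ.neg-distribˡ-* (sign a) (sign b) ⟩
  - sign a * sign b       ≡⟨ cong (_* sign b) (sym (sign-suc a)) ⟩
  sign (suc a) * sign b   ∎
  where open ≡-Reasoning

sign-*-sign : ∀ n → sign n * sign n ≡ 1ℚ
sign-*-sign zero          = refl
sign-*-sign (suc zero)    = refl
sign-*-sign (suc (suc n)) = sign-*-sign n

signℚ-+ : ∀ n → signℚ (+ n) ≡ sign n
signℚ-+ zero          = refl
signℚ-+ (suc zero)    = refl
signℚ-+ (suc (suc n)) = signℚ-+ n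

signℚ-⊖ : ∀ a c → signℚ (a ⊖ c) ≡ sign a * sign c
signℚ-⊖ a       zero    = trans (signℚ-+ a) (sym (ℚ.*-identityʳ (sign a)))
signℚ-⊖ zero    (suc c) = trans (signℚ-+ (suc c)) (sym (ℚ.*-identityˡ _))
signℚ-⊖ (suc a) (suc c) = begin
  signℚ (suc a ⊖ suc c)          ≡⟨ cong signℚ (ℤ.[1+m]⊖[1+n]≡m⊖n a c) ⟩
  signℚ (a ⊖ c)                  ≡⟨ signℚ-⊖ a c ⟩
  sign a * sign c                ≡⟨ solve 2 (λ x y → x :* y := (:- x) :* (:- y)) refl (sign a) (sign c) ⟩
  (- sign a) * (- sign c)        ≡⟨ sym (cong₂ _*_ (sign-suc a) (sign-suc c)) ⟩
  sign (suc a) * sign (suc c)    ∎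
  where open ≡-Reasoning

signℚ-sub : ∀ a c → signℚ (+ a ℤ.- + c) ≡ sign a * sign c
signℚ-sub a c = trans (cong signℚ (ℤ.m-n≡m⊖n a c)) (signℚ-⊖ a c)

∑∈-sublists-∷ : (G : List ℕ → ℚ) (x : ℕ) (L : List ℕ) →
                ∑∈ G (sublists (x ∷ L)) ≡ (∑[ S ∈ sublists L ] G (x ∷ S)) + ∑∈ G (sublists L)
∑∈-sublists-∷ G x L = trans (∑∈-++ G (map (x ∷_) (sublists L)) (sublists L))
                            (cong (_+ ∑∈ G (sublists L)) (∑∈-map G (x ∷_) (sublists L)))

m<n⇒m-n<0 : ∀ {m n : ℤ} → m ℤ.< n → m ℤ.- n ℤ.< + 0
m<n⇒m-n<0 {m} {n} m<n = subst (m ℤ.- n ℤ.<_) (ℤ.+-inverseʳ n) (ℤ.+-monoˡ-< (ℤ.- n) m<n)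

i-j-k≡i-[j+k] : ∀ i j k → i ℤ.- j ℤ.- k ≡ i ℤ.- (j ℤ.+ k)
i-j-k≡i-[j+k] i j k = trans (ℤ.+-assoc i (ℤ.- j) (ℤ.- k)) (cong (ℤ._+_ i) (sym (ℤ.neg-distrib-+ j k)))

+≡⇔≡- : (a b c : ℤ) → a ℤ.+ b ≡ c ⇔ b ≡ c ℤ.- a
+≡⇔≡- a b c = mk⇔ (λ e → trans (cancel a b) (cong (ℤ._- a) e)) (λ e → trans (cong (ℤ._+_ a) e) (restore a c))
  where
  cancel : ∀ a b → b ≡ (a ℤ.+ b) ℤ.- a
  cancel = solveℤ 2 (λ a b → b ≐ (a ⊕ b) ⊝ a) refl
  restore : ∀ a c → a ℤ.+ (c ℤ.- a) ≡ c
  restore = solveℤ 2 (λ a c → a ⊕ (c ⊝ a) ≐ c) refl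

-- The coefficient of q^M in ∏_{x ∈ L} (1 − q^x).
signedCount : List ℕ → ℤ → ℚ
signedCount L M = ∑[ S ∈ sublists L ] sign (length S) * 𝟙 (+ sum S ℤ.≟ M)

signedCount-∷ : ∀ x L M → signedCount (x ∷ L) M ≡ signedCount L M - signedCount L (M ℤ.- + x)
signedCount-∷ x L M = begin
  signedCount (x ∷ L) M
    ≡⟨ ∑∈-sublists-∷ _ x L ⟩
  (∑[ S ∈ sublists L ] sign (suc (length S)) * 𝟙 (+ (x ℕ.+ sum S) ℤ.≟ M)) + signedCount L M
    ≡⟨ cong (_+ signedCount L M) (trans (∑∈-cong (sublists L) peel) (∑∈-neg _ (sublists L))) ⟩
  - signedCount L (M ℤ.- + x) + signedCount L M
    ≡⟨ ℚ.+-comm _ (signedCount L M) ⟩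
  signedCount L M - signedCount L (M ℤ.- + x) ∎
  where
  open ≡-Reasoning
  peel : ∀ S → sign (suc (length S)) * 𝟙 (+ (x ℕ.+ sum S) ℤ.≟ M)
             ≡ - (sign (length S) * 𝟙 (+ sum S ℤ.≟ M ℤ.- + x))
  peel S = begin
    sign (suc (length S)) * 𝟙 (+ (x ℕ.+ sum S) ℤ.≟ M)
      ≡⟨ cong₂ _*_ (sign-suc (length S)) (𝟙-⇔ (+≡⇔≡- (+ x) (+ sum S) M) (+ x ℤ.+ + sum S ℤ.≟ M) (+ sum S ℤ.≟ M ℤ.- + x)) ⟩
    - sign (length S) * 𝟙 (+ sum S ℤ.≟ M ℤ.- + x)
      ≡⟨ sym (ℚ.neg-distribˡ-* (sign (length S)) _) ⟩
    - (sign (length S) * 𝟙 (+ sum S ℤ.≟ M ℤ.- + x)) ∎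

signedCount-∷ʳ : ∀ x L M → signedCount (L ++ [ x ]) M ≡ signedCount L M - signedCount L (M ℤ.- + x)
signedCount-∷ʳ x []      M = signedCount-∷ x [] M
signedCount-∷ʳ x (y ∷ L) M = begin
  signedCount (y ∷ L ++ [ x ]) M
    ≡⟨ signedCount-∷ y (L ++ [ x ]) M ⟩
  signedCount (L ++ [ x ]) M - signedCount (L ++ [ x ]) (M ℤ.- + y)
    ≡⟨ cong₂ _-_ (signedCount-∷ʳ x L M) (signedCount-∷ʳ x L (M ℤ.- + y)) ⟩
  (Y M - Y (M ℤ.- + x)) - (Y (M ℤ.- + y) - Y (M ℤ.- + y ℤ.- + x))
    ≡⟨ cong (λ z → (Y M - Y (M ℤ.- + x)) - (Y (M ℤ.- + y) - Y z)) (swap-subtrahends M (+ y) (+ x)) ⟩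
  (Y M - Y (M ℤ.- + x)) - (Y (M ℤ.- + y) - Y (M ℤ.- + x ℤ.- + y))
    ≡⟨ solve 4 (λ a b c d → (a :- b) :- (c :- d) := (a :- c) :- (b :- d)) refl
              (Y M) (Y (M ℤ.- + x)) (Y (M ℤ.- + y)) (Y (M ℤ.- + x ℤ.- + y)) ⟩
  (Y M - Y (M ℤ.- + y)) - (Y (M ℤ.- + x) - Y (M ℤ.- + x ℤ.- + y))
    ≡⟨ sym (cong₂ _-_ (signedCount-∷ y L M) (signedCount-∷ y L (M ℤ.- + x))) ⟩
  signedCount (y ∷ L) M - signedCount (y ∷ L) (M ℤ.- + x) ∎
  where
  open ≡-Reasoning
  Y = signedCount L
  swap-subtrahends : ∀ i j k → i ℤ.- j ℤ.- k ≡ i ℤ.- k ℤ.- j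
  swap-subtrahends i j k = trans (i-j-k≡i-[j+k] i j k) (trans (cong (ℤ._-_ i) (ℤ.+-comm j k)) (sym (i-j-k≡i-[j+k] i k j)))

signedCount-above : ∀ L M → All (λ x → M ℤ.< + x) L → signedCount L M ≡ 𝟙 (+ 0 ℤ.≟ M)
signedCount-above []      M []         = trans (ℚ.+-identityʳ _) (ℚ.*-identityˡ _)
signedCount-above (x ∷ L) M (M<x ∷ M<L) = begin
  signedCount (x ∷ L) M
    ≡⟨ signedCount-∷ x L M ⟩
  signedCount L M - signedCount L (M ℤ.- + x)
    ≡⟨ cong₂ _-_ (signedCount-above L M M<L) (signedCount-above L _ M-x<L) ⟩
  𝟙 (+ 0 ℤ.≟ M) - 𝟙 (+ 0 ℤ.≟ M ℤ.- + x)
    ≡⟨ cong (_-_ (𝟙 (+ 0 ℤ.≟ M))) (𝟙-no (+ 0 ℤ.≟ M ℤ.- + x) (λ e → ℤ.<-irrefl (sym e) M-x<0)) ⟩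
  𝟙 (+ 0 ℤ.≟ M) - 0ℚ
    ≡⟨ ℚ.+-identityʳ _ ⟩
  𝟙 (+ 0 ℤ.≟ M) ∎
  where
  open ≡-Reasoning
  M-x<0 : M ℤ.- + x ℤ.< + 0
  M-x<0 = m<n⇒m-n<0 M<x
  M-x<L : All (λ y → M ℤ.- + x ℤ.< + y) L
  M-x<L = All.tabulate (λ _ → ℤ.<-≤-trans M-x<0 (ℤ.+≤+ z≤n))

signedCount-negative : ∀ L M → M ℤ.< + 0 → signedCount L M ≡ 0ℚ
signedCount-negative L M M<0 =
  trans (signedCount-above L M (All.tabulate (λ _ → ℤ.<-≤-trans M<0 (ℤ.+≤+ z≤n))))
        (𝟙-no (+ 0 ℤ.≟ M) (λ e → ℤ.<-irrefl (sym e) M<0))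

window : ℕ → ℕ → List ℕ
window c zero    = []
window c (suc u) = suc (u ℕ.+ c) ∷ window c u

window-suc : ∀ c u → window c (suc u) ≡ window (suc c) u ++ [ suc c ]
window-suc c zero    = refl
window-suc c (suc u) = cong₂ _∷_ (cong suc (sym (ℕ.+-suc u c))) (window-suc c u)

window-above : ∀ c u → All (c <_) (window c u)
window-above c zero    = []
window-above c (suc u) = s≤s (ℕ.m≤n+m c u) ∷ window-above c u

signedCount-window-peel : ∀ c u M →
  signedCount (window c u) M - signedCount (window c u) (M ℤ.- + suc (u ℕ.+ c))
    ≡ signedCount (window (suc c) u) M - signedCount (window (suc c) u) (M ℤ.- + suc c)
signedCount-window-peel c u M = begin
  signedCount (window c u) M - signedCount (window c u) (M ℤ.- + suc (u ℕ.+ c))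
    ≡⟨ sym (signedCount-∷ (suc (u ℕ.+ c)) (window c u) M) ⟩
  signedCount (window c (suc u)) M
    ≡⟨ cong (λ L → signedCount L M) (window-suc c u) ⟩
  signedCount (window (suc c) u ++ [ suc c ]) M
    ≡⟨ signedCount-∷ʳ (suc c) (window (suc c) u) M ⟩
  signedCount (window (suc c) u) M - signedCount (window (suc c) u) (M ℤ.- + suc c) ∎
  where open ≡-Reasoning

module _ (u : ℕ) where

  windowCount : ℕ → ℤ → ℚ
  windowCount c = signedCount (window c u)

  -- The coefficient of q^N in ∑_{c<K} q^c ∏_{j=c+1}^{c+u} (1 − q^j), which agrees with 1/(1 − q^(u+1))
  -- below degree K.
  cumulativeCount : ℕ → ℤ → ℚ
  cumulativeCount K N = ∑[ c < K ] windowCount c (N ℤ.- + c)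

  cumulativeCount-difference : ∀ K N →
    cumulativeCount K N - cumulativeCount K (N ℤ.- + suc u) ≡ windowCount K N - windowCount K (N ℤ.- + K)
  cumulativeCount-difference K N = begin
    X N - X (N ℤ.- + suc u)
      ≡⟨ cong (_-_ (X N)) shifted ⟩
    X N - A
      ≡⟨ solve 3 (λ x a p → x :- a := ((x :+ p) :- a) :- p) refl (X N) A (Q K (N ℤ.- + K)) ⟩
    ((X N + Q K (N ℤ.- + K)) - A) - Q K (N ℤ.- + K)
      ≡⟨ cong (λ z → (z - A) - Q K (N ℤ.- + K)) reindexed ⟩
    ((B + Q 0 N) - A) - Q K (N ℤ.- + K)
      ≡⟨ solve 4 (λ b q a p → ((b :+ q) :- a) :- p := (q :- (a :- b)) :- p) refl B (Q 0 N) A (Q K (N ℤ.- + K)) ⟩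
    (Q 0 N - (A - B)) - Q K (N ℤ.- + K)
      ≡⟨ cong (λ z → (Q 0 N - z) - Q K (N ℤ.- + K)) (sym telescoped) ⟩
    (Q 0 N - (Q 0 N - Q K N)) - Q K (N ℤ.- + K)
      ≡⟨ solve 3 (λ q q' p → (q :- (q :- q')) :- p := q' :- p) refl (Q 0 N) (Q K N) (Q K (N ℤ.- + K)) ⟩
    Q K N - Q K (N ℤ.- + K) ∎
    where
    open ≡-Reasoning
    Q = windowCount
    X = cumulativeCount K
    A B : ℚ
    A = ∑[ c < K ] Q c (N ℤ.- + suc (u ℕ.+ c))
    B = ∑[ c < K ] Q (suc c) (N ℤ.- + suc c)
    shifted : X (N ℤ.- + suc u) ≡ A
    shifted = ∑<-cong K (λ {c} _ → cong (Q c) (i-j-k≡i-[j+k] N (+ suc u) (+ c)))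
    reindexed : X N + Q K (N ℤ.- + K) ≡ B + Q 0 N
    reindexed = begin
      X N + Q K (N ℤ.- + K)                   ≡⟨ ∑<-suc K (λ c → Q c (N ℤ.- + c)) ⟩
      Q 0 (N ℤ.- + 0) + B                     ≡⟨ cong (λ z → Q 0 z + B) (ℤ.+-identityʳ N) ⟩
      Q 0 N + B                               ≡⟨ ℚ.+-comm (Q 0 N) B ⟩
      B + Q 0 N                               ∎
    telescoped : Q 0 N - Q K N ≡ A - B
    telescoped = begin
      Q 0 N - Q K N
        ≡⟨ sym (∑<-telescope K (λ c → Q c N)) ⟩
      ∑[ c < K ] (Q c N - Q (suc c) N)
        ≡⟨ ∑<-cong K (λ {c} _ → rearrange (Q c N) _ (Q (suc c) N) _ (signedCount-window-peel c u N)) ⟩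
      ∑[ c < K ] (Q c (N ℤ.- + suc (u ℕ.+ c)) - Q (suc c) (N ℤ.- + suc c))
        ≡⟨ ∑<-sub K _ _ ⟩
      A - B ∎
      where
      rearrange : ∀ a a' b b' → a - a' ≡ b - b' → a - b ≡ a' - b'
      rearrange a a' b b' e = begin
        a - b
          ≡⟨ solve 4 (λ a a' b b' → a :- b := (a' :- b') :+ ((a :- a') :- (b :- b'))) refl a a' b b' ⟩
        (a' - b') + ((a - a') - (b - b'))
          ≡⟨ cong (λ z → (a' - b') + (z - (b - b'))) e ⟩
        (a' - b') + ((b - b') - (b - b'))
          ≡⟨ cong (_+_ (a' - b')) (ℚ.+-inverseʳ (b - b')) ⟩
        (a' - b') + 0ℚ
          ≡⟨ ℚ.+-identityʳ _ ⟩
        a' - b' ∎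

  cumulativeCount-step : ∀ K N → N ℤ.< + K →
    cumulativeCount K N ≡ 𝟙 (+ 0 ℤ.≟ N) + cumulativeCount K (N ℤ.- + suc u)
  cumulativeCount-step K N N<K = begin
    X N                                                 ≡⟨ solve 2 (λ x y → x := (x :- y) :+ y) refl (X N) (X N′) ⟩
    (X N - X N′) + X N′                                  ≡⟨ cong (_+ X N′) (cumulativeCount-difference K N) ⟩
    (windowCount K N - windowCount K (N ℤ.- + K)) + X N′ ≡⟨ cong (λ z → (windowCount K N - z) + X N′) beyond ⟩
    (windowCount K N - 0ℚ) + X N′                        ≡⟨ cong (_+ X N′) (trans (ℚ.+-identityʳ _) below) ⟩
    𝟙 (+ 0 ℤ.≟ N) + X N′                                 ∎
    where
    open ≡-Reasoning
    X = cumulativeCount K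
    N′ = N ℤ.- + suc u
    below : windowCount K N ≡ 𝟙 (+ 0 ℤ.≟ N)
    below = signedCount-above (window K u) N (All.map (λ K<x → ℤ.<-trans N<K (ℤ.+<+ K<x)) (window-above K u))
    beyond : windowCount K (N ℤ.- + K) ≡ 0ℚ
    beyond = signedCount-negative (window K u) _ (m<n⇒m-n<0 N<K)

  cumulativeCount-negative : ∀ K N → N ℤ.< + 0 → cumulativeCount K N ≡ 0ℚ
  cumulativeCount-negative K N N<0 =
    trans (∑<-cong K (λ {c} _ → signedCount-negative (window c u) _ (ℤ.≤-<-trans (ℤ.i-j≤i N (+ c)) N<0)))
          (∑<-zero K)

  cumulativeCount-periodic : ∀ q ρ K → ρ < suc u → ρ ℕ.+ q ℕ.* suc u < K →
                             cumulativeCount K (+ (ρ ℕ.+ q ℕ.* suc u)) ≡ 𝟙 (ρ ℕ.≟ 0)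
  cumulativeCount-periodic zero ρ K ρ<d ρ<K rewrite ℕ.+-identityʳ ρ = begin
    cumulativeCount K (+ ρ)
      ≡⟨ cumulativeCount-step K (+ ρ) (ℤ.+<+ ρ<K) ⟩
    𝟙 (+ 0 ℤ.≟ + ρ) + cumulativeCount K (+ ρ ℤ.- + suc u)
      ≡⟨ cong (_+_ (𝟙 (+ 0 ℤ.≟ + ρ))) (cumulativeCount-negative K _ (m<n⇒m-n<0 (ℤ.+<+ ρ<d))) ⟩
    𝟙 (+ 0 ℤ.≟ + ρ) + 0ℚ
      ≡⟨ ℚ.+-identityʳ _ ⟩
    𝟙 (+ 0 ℤ.≟ + ρ)
      ≡⟨ 𝟙-⇔ (mk⇔ (λ e → sym (ℤ.+-injective e)) (λ e → cong +_ (sym e))) (+ 0 ℤ.≟ + ρ) (ρ ℕ.≟ 0) ⟩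
    𝟙 (ρ ℕ.≟ 0) ∎
    where open ≡-Reasoning
  cumulativeCount-periodic (suc q) ρ K ρ<d N<K = begin
    cumulativeCount K (+ N)
      ≡⟨ cumulativeCount-step K (+ N) (ℤ.+<+ N<K) ⟩
    𝟙 (+ 0 ℤ.≟ + N) + cumulativeCount K (+ N ℤ.- + suc u)
      ≡⟨ cong₂ _+_ (𝟙-no (+ 0 ℤ.≟ + N) N≢0) (cong (cumulativeCount K) unshift) ⟩
    0ℚ + cumulativeCount K (+ (ρ ℕ.+ q ℕ.* suc u))
      ≡⟨ ℚ.+-identityˡ _ ⟩
    cumulativeCount K (+ (ρ ℕ.+ q ℕ.* suc u))
      ≡⟨ cumulativeCount-periodic q ρ K ρ<d (ℕ.≤-trans (s≤s (ℕ.+-monoʳ-≤ ρ (ℕ.m≤n+m _ (suc u)))) N<K) ⟩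
    𝟙 (ρ ℕ.≟ 0) ∎
    where
    open ≡-Reasoning
    N = ρ ℕ.+ suc q ℕ.* suc u
    N≢0 : + 0 ≢ + N
    N≢0 e = ℕ.m+1+n≢0 ρ (sym (ℤ.+-injective e))
    unshift : + N ℤ.- + suc u ≡ + (ρ ℕ.+ q ℕ.* suc u)
    unshift = solveℤ 3 (λ r d t → (r ⊕ (d ⊕ t)) ⊝ d ≐ r ⊕ t) refl (+ ρ) (+ suc u) (+ (q ℕ.* suc u))

  cumulativeCount-divisor : ∀ K N → N < K → cumulativeCount K (+ N) ≡ 𝟙 (suc u ∣? N)
  cumulativeCount-divisor K N N<K = begin
    cumulativeCount K (+ N)
      ≡⟨ cong (λ z → cumulativeCount K (+ z)) N≡ρ+qd ⟩
    cumulativeCount K (+ (N % suc u ℕ.+ N / suc u ℕ.* suc u))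
      ≡⟨ cumulativeCount-periodic (N / suc u) (N % suc u) K (m%n<n N (suc u)) (subst (_< K) N≡ρ+qd N<K) ⟩
    𝟙 (N % suc u ℕ.≟ 0)
      ≡⟨ 𝟙-⇔ (m%n≡0⇔n∣m N (suc u)) (N % suc u ℕ.≟ 0) (suc u ∣? N) ⟩
    𝟙 (suc u ∣? N) ∎
    where
    open ≡-Reasoning
    N≡ρ+qd : N ≡ N % suc u ℕ.+ N / suc u ℕ.* suc u
    N≡ρ+qd = m≡m%n+[m/n]*n N (suc u)

DescendingBelow : ℕ → List ℕ → Set
DescendingBelow b []      = ⊤
DescendingBelow b (x ∷ S) = x < b × DescendingBelow x S

sublists-downFrom1-descending : ∀ j b → j < b → All (DescendingBelow b) (sublists (downFrom1 j))
sublists-downFrom1-descending zero    b _   = tt ∷ []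
sublists-downFrom1-descending (suc j) b j<b =
  All.++⁺ (All.map⁺ (All.map (j<b ,_) (sublists-downFrom1-descending j (suc j) ℕ.≤-refl)))
          (sublists-downFrom1-descending j b (ℕ.<-trans (ℕ.n<1+n j) j<b))

smallest-≤ : ∀ b S → DescendingBelow b S → smallest (b ∷ S) ≤ b
smallest-≤ b []      _          = ℕ.≤-refl
smallest-≤ b (x ∷ S) (x<b , dS) = ℕ.≤-trans (smallest-≤ x S dS) (ℕ.<⇒≤ x<b)

<smallest⇔ : ∀ t b S → DescendingBelow b S → t < smallest (b ∷ S) ⇔ (t < b × All (t <_) S)
<smallest⇔ t b []      _          = mk⇔ (_, []) proj₁
<smallest⇔ t b (x ∷ S) (x<b , dS) = mk⇔ to from
  where
  open Equivalence (<smallest⇔ t x S dS) renaming (to to to′; from to from′)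
  to : t < smallest (x ∷ S) → t < b × All (t <_) (x ∷ S)
  to t<s with to′ t<s
  ... | t<x , t<S = ℕ.<-trans t<x x<b , t<x ∷ t<S
  from : t < b × All (t <_) (x ∷ S) → t < smallest (x ∷ S)
  from (_ , t<x ∷ t<S) = from′ (t<x , t<S)

∑∈-sublists-downFrom1 : (G : List ℕ → ℚ) (n : ℕ) →
  ∑∈ G (sublists (downFrom1 n)) ≡ G [] + (∑[ i < n ] ∑[ S ∈ sublists (downFrom1 i) ] G (suc i ∷ S))
∑∈-sublists-downFrom1 G zero    = refl
∑∈-sublists-downFrom1 G (suc n) = begin
  ∑∈ G (sublists (downFrom1 (suc n)))
    ≡⟨ ∑∈-sublists-∷ G (suc n) (downFrom1 n) ⟩
  T n + ∑∈ G (sublists (downFrom1 n))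
    ≡⟨ cong (_+_ (T n)) (∑∈-sublists-downFrom1 G n) ⟩
  T n + (G [] + ∑< n T)
    ≡⟨ solve 3 (λ t g s → t :+ (g :+ s) := g :+ (s :+ t)) refl (T n) (G []) (∑< n T) ⟩
  G [] + (∑< n T + T n) ∎
  where
  open ≡-Reasoning
  T : ℕ → ℚ
  T i = ∑[ S ∈ sublists (downFrom1 i) ] G (suc i ∷ S)

above? : (c : ℕ) (S : List ℕ) → Dec (All (c <_) S)
above? c = all? (c ℕ.<?_)

∑∈-sublists-below : (G : List ℕ → ℚ) (c j : ℕ) → j ≤ c →
  ∑[ S ∈ sublists (downFrom1 j) ] 𝟙 (above? c S) * G S ≡ G []
∑∈-sublists-below G c zero    _   = trans (ℚ.+-identityʳ _) (ℚ.*-identityˡ (G []))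
∑∈-sublists-below G c (suc j) j<c = begin
  ∑[ S ∈ sublists (downFrom1 (suc j)) ] 𝟙 (above? c S) * G S
    ≡⟨ ∑∈-sublists-∷ _ (suc j) (downFrom1 j) ⟩
  (∑[ S ∈ sublists (downFrom1 j) ] 𝟙 (above? c (suc j ∷ S)) * G (suc j ∷ S))
    + (∑[ S ∈ sublists (downFrom1 j) ] 𝟙 (above? c S) * G S)
    ≡⟨ cong₂ _+_ (trans (∑∈-cong (sublists (downFrom1 j)) excluded) (∑∈-zero (sublists (downFrom1 j))))
                 (∑∈-sublists-below G c j (ℕ.<⇒≤ j<c)) ⟩
  0ℚ + G []
    ≡⟨ ℚ.+-identityˡ (G []) ⟩
  G [] ∎
  where
  open ≡-Reasoning
  excluded : ∀ S → 𝟙 (above? c (suc j ∷ S)) * G (suc j ∷ S) ≡ 0ℚ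
  excluded S = 𝟙-no-* (above? c (suc j ∷ S)) (λ { (c<j ∷ _) → ℕ.<⇒≱ c<j j<c }) _

∑∈-sublists-window : (G : List ℕ → ℚ) (c u : ℕ) →
  ∑[ S ∈ sublists (downFrom1 (u ℕ.+ c)) ] 𝟙 (above? c S) * G S ≡ ∑∈ G (sublists (window c u))
∑∈-sublists-window G c zero    = trans (∑∈-sublists-below G c c ℕ.≤-refl) (sym (ℚ.+-identityʳ (G [])))
∑∈-sublists-window G c (suc u) = begin
  ∑[ S ∈ sublists (x ∷ downFrom1 (u ℕ.+ c)) ] 𝟙 (above? c S) * G S
    ≡⟨ ∑∈-sublists-∷ _ x (downFrom1 (u ℕ.+ c)) ⟩
  (∑[ S ∈ sublists (downFrom1 (u ℕ.+ c)) ] 𝟙 (above? c (x ∷ S)) * G (x ∷ S))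
    + (∑[ S ∈ sublists (downFrom1 (u ℕ.+ c)) ] 𝟙 (above? c S) * G S)
    ≡⟨ cong₂ _+_ (trans (∑∈-cong (sublists (downFrom1 (u ℕ.+ c))) head-above) (∑∈-sublists-window (λ S → G (x ∷ S)) c u))
                 (∑∈-sublists-window G c u) ⟩
  (∑[ S ∈ sublists (window c u) ] G (x ∷ S)) + ∑∈ G (sublists (window c u))
    ≡⟨ sym (∑∈-sublists-∷ G x (window c u)) ⟩
  ∑∈ G (sublists (window c (suc u))) ∎
  where
  open ≡-Reasoning
  x = suc (u ℕ.+ c)
  head-above : ∀ S → 𝟙 (above? c (x ∷ S)) * G (x ∷ S) ≡ 𝟙 (above? c S) * G (x ∷ S)
  head-above S = cong (_* G (x ∷ S)) (𝟙-⇔ (mk⇔ All.tail (s≤s (ℕ.m≤n+m c u) ∷_)) (above? c (x ∷ S)) (above? c S))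

sumFrom1-alternating : ∀ m a s →
  sumFrom1 s (λ j → signℚ (+ j) * powℤ (a ℕ.+ j) m) ≡ sign a * (∑[ j < s ] rhsTerm m (suc (a ℕ.+ j)))
sumFrom1-alternating m a s = begin
  sumFrom1 s (λ j → signℚ (+ j) * powℤ (a ℕ.+ j) m)              ≡⟨ sumℚ-applyUpTo _ s ⟩
  ∑[ j < s ] signℚ (+ suc j) * powℤ (a ℕ.+ suc j) m              ≡⟨ ∑<-cong s (λ {j} _ → factor j) ⟩
  ∑[ j < s ] sign a * rhsTerm m (suc (a ℕ.+ j))                   ≡⟨ ∑<-distribˡ s (sign a) _ ⟩
  sign a * (∑[ j < s ] rhsTerm m (suc (a ℕ.+ j)))                   ∎
  where
  open ≡-Reasoning
  factor : ∀ j → signℚ (+ suc j) * powℤ (a ℕ.+ suc j) m ≡ sign a * rhsTerm m (suc (a ℕ.+ j))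
  factor j = begin
    signℚ (+ suc j) * p
      ≡⟨ cong (_* p) (signℚ-+ (suc j)) ⟩
    sign (suc j) * p
      ≡⟨ sym (ℚ.*-identityˡ _) ⟩
    1ℚ * (sign (suc j) * p)
      ≡⟨ cong (_* (sign (suc j) * p)) (sym (sign-*-sign a)) ⟩
    (sign a * sign a) * (sign (suc j) * p)
      ≡⟨ solve 3 (λ x y p → (x :* x) :* (y :* p) := x :* ((x :* y) :* p)) refl (sign a) (sign (suc j)) p ⟩
    sign a * ((sign a * sign (suc j)) * p)
      ≡⟨ cong (λ z → sign a * (z * p)) (sym (trans (signℚ-+ (a ℕ.+ suc j)) (sign-+ a (suc j)))) ⟩
    sign a * rhsTerm m (a ℕ.+ suc j)
      ≡⟨ cong (λ d → sign a * rhsTerm m d) (ℕ.+-suc a j) ⟩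
    sign a * rhsTerm m (suc (a ℕ.+ j)) ∎
    where p = powℤ (a ℕ.+ suc j) m

lhsTerm-sign : ∀ b S → smallest (b ∷ S) ≤ b →
  signℚ (rank (b ∷ S) ℤ.+ + smallest (b ∷ S) ℤ.- + 1) ≡ sign (b ∸ smallest (b ∷ S)) * sign (length S)
lhsTerm-sign b S s≤b = begin
  signℚ ((+ b ℤ.- + suc k) ℤ.+ + s ℤ.- + 1)
    ≡⟨ cong signℚ (solveℤ 4 (λ b k s o → ((b ⊝ k) ⊕ s) ⊝ o ≐ (b ⊕ s) ⊝ (k ⊕ o)) refl (+ b) (+ suc k) (+ s) (+ 1)) ⟩
  signℚ (+ (b ℕ.+ s) ℤ.- + (suc k ℕ.+ 1))
    ≡⟨ signℚ-sub (b ℕ.+ s) (suc k ℕ.+ 1) ⟩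
  sign (b ℕ.+ s) * sign (suc k ℕ.+ 1)
    ≡⟨ cong₂ _*_ parity (cong sign (ℕ.+-comm (suc k) 1)) ⟩
  sign a * sign k ∎
  where
  open ≡-Reasoning
  s = smallest (b ∷ S)
  k = length S
  a = b ∸ s
  parity : sign (b ℕ.+ s) ≡ sign a
  parity = begin
    sign (b ℕ.+ s)               ≡⟨ cong (λ z → sign (z ℕ.+ s)) (sym (ℕ.m∸n+n≡m s≤b)) ⟩
    sign (a ℕ.+ s ℕ.+ s)         ≡⟨ trans (cong sign (ℕ.+-assoc a s s)) (sign-+ a (s ℕ.+ s)) ⟩
    sign a * sign (s ℕ.+ s)      ≡⟨ cong (_*_ (sign a)) (trans (sign-+ s s) (sign-*-sign s)) ⟩
    sign a * 1ℚ                  ≡⟨ ℚ.*-identityʳ (sign a) ⟩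
    sign a                       ∎

lhsTerm-∷ : ∀ m b S → smallest (b ∷ S) ≤ b →
  lhsTerm m (b ∷ S) ≡ sign (length S) * (∑[ r < b ] 𝟙 (b ∸ smallest (b ∷ S) ℕ.≤? r) * rhsTerm m (suc r))
lhsTerm-∷ m b S s≤b = begin
  lhsTerm m (b ∷ S)
    ≡⟨ cong₂ _*_ (lhsTerm-sign b S s≤b) (sumFrom1-alternating m a s) ⟩
  (sign a * sign k) * (sign a * (∑[ j < s ] w (suc (a ℕ.+ j))))
    ≡⟨ cancel (sign k) _ ⟩
  sign k * (∑[ j < s ] w (suc (a ℕ.+ j)))
    ≡⟨ cong (_*_ (sign k)) (sym (∑<-restrict-≥ a s (λ r → w (suc r)))) ⟩
  sign k * (∑[ r < a ℕ.+ s ] 𝟙 (a ℕ.≤? r) * w (suc r))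
    ≡⟨ cong (λ z → sign k * (∑[ r < z ] 𝟙 (a ℕ.≤? r) * w (suc r))) (ℕ.m∸n+n≡m s≤b) ⟩
  sign k * (∑[ r < b ] 𝟙 (a ℕ.≤? r) * w (suc r)) ∎
  where
  open ≡-Reasoning
  s = smallest (b ∷ S)
  k = length S
  a = b ∸ s
  w = rhsTerm m
  cancel : ∀ y z → (sign a * y) * (sign a * z) ≡ y * z
  cancel y z = begin
    (sign a * y) * (sign a * z)  ≡⟨ solve 3 (λ x y z → (x :* y) :* (x :* z) := (x :* x) :* (y :* z)) refl (sign a) y z ⟩
    (sign a * sign a) * (y * z)  ≡⟨ cong (_* (y * z)) (sign-*-sign a) ⟩
    1ℚ * (y * z)                 ≡⟨ ℚ.*-identityˡ (y * z) ⟩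
    y * z                        ∎

∸≤-swap : ∀ m n o → m ∸ n ≤ o → m ∸ o ≤ n
∸≤-swap m n o m∸n≤o = ℕ.m≤n+o⇒m∸n≤o m o (begin
  m            ≤⟨ ℕ.m≤n+m∸n m n ⟩
  n ℕ.+ (m ∸ n) ≤⟨ ℕ.+-monoʳ-≤ n m∸n≤o ⟩
  n ℕ.+ o       ≡⟨ ℕ.+-comm n o ⟩
  o ℕ.+ n       ∎)
  where open ℕ.≤-Reasoning

descending-window⇔ : ∀ i S r → DescendingBelow (suc i) S → r ≤ i →
  suc i ∸ smallest (suc i ∷ S) ≤ r ⇔ All (i ∸ r <_) S
descending-window⇔ i S r dS r≤i = mk⇔
  (λ le → proj₂ (to (subst (_≤ s) 1+i∸r (∸≤-swap (suc i) s r le))))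
  (λ i∸r<S → ∸≤-swap (suc i) r s (subst (_≤ s) (sym 1+i∸r) (from (s≤s (ℕ.m∸n≤m i r) , i∸r<S))))
  where
  open Equivalence (<smallest⇔ (i ∸ r) (suc i) S dS)
  s = smallest (suc i ∷ S)
  1+i∸r : suc i ∸ r ≡ suc (i ∸ r)
  1+i∸r = ℕ.+-∸-assoc 1 r≤i

-- rhsTerm m (r + 1) enters lhsTerm m (suc i ∷ S) iff the parts lie in the window (i − r, i + 1].
contribution : ℕ → ℕ → List ℕ → ℕ → ℚ
contribution n i S r = 𝟙 (r ℕ.≤? i) * (𝟙 (above? (i ∸ r) S) * (sign (length S) * 𝟙 (suc i ℕ.+ sum S ℕ.≟ n)))

lhsTerm-expand : ∀ m n i S → i < n → DescendingBelow (suc i) S →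
  𝟙 (suc i ℕ.+ sum S ℕ.≟ n) * lhsTerm m (suc i ∷ S) ≡ ∑[ r < n ] rhsTerm m (suc r) * contribution n i S r
lhsTerm-expand m n i S i<n dS = begin
  ι * lhsTerm m (suc i ∷ S)
    ≡⟨ cong (_*_ ι) (lhsTerm-∷ m (suc i) S (smallest-≤ (suc i) S dS)) ⟩
  ι * (k * (∑[ r < suc i ] 𝟙 (suc i ∸ smallest (suc i ∷ S) ℕ.≤? r) * w (suc r)))
    ≡⟨ cong (λ z → ι * (k * z)) (∑<-cong (suc i) (λ {r} r<1+i → cong (_* w (suc r)) (window-condition r (ℕ.≤-pred r<1+i)))) ⟩
  ι * (k * (∑[ r < suc i ] 𝟙 (above? (i ∸ r) S) * w (suc r)))
    ≡⟨ cong (λ z → ι * (k * z)) (sym (trans (cong (λ z → ∑[ r < z ] 𝟙 (r ℕ.<? suc i) * f r) (sym (ℕ.m+[n∸m]≡n i<n)))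
                                                  (∑<-restrict-< (suc i) (n ∸ suc i) f))) ⟩
  ι * (k * (∑[ r < n ] 𝟙 (r ℕ.<? suc i) * f r))
    ≡⟨ trans (cong (_*_ ι) (sym (∑<-distribˡ n k _))) (sym (∑<-distribˡ n ι _)) ⟩
  ∑[ r < n ] ι * (k * (𝟙 (r ℕ.<? suc i) * f r))
    ≡⟨ ∑<-cong n (λ {r} _ → reorder r) ⟩
  ∑[ r < n ] w (suc r) * contribution n i S r ∎
  where
  open ≡-Reasoning
  ι = 𝟙 (suc i ℕ.+ sum S ℕ.≟ n)
  k = sign (length S)
  w = rhsTerm m
  f : ℕ → ℚ
  f r = 𝟙 (above? (i ∸ r) S) * w (suc r)
  window-condition : ∀ r → r ≤ i → 𝟙 (suc i ∸ smallest (suc i ∷ S) ℕ.≤? r) ≡ 𝟙 (above? (i ∸ r) S)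
  window-condition r r≤i = 𝟙-⇔ (descending-window⇔ i S r dS r≤i) (suc i ∸ smallest (suc i ∷ S) ℕ.≤? r) (above? (i ∸ r) S)
  reorder : ∀ r → ι * (k * (𝟙 (r ℕ.<? suc i) * f r)) ≡ w (suc r) * contribution n i S r
  reorder r = begin
    ι * (k * (𝟙 (r ℕ.<? suc i) * (𝟙 (above? (i ∸ r) S) * w (suc r))))
      ≡⟨ cong (λ z → ι * (k * (z * f r))) (𝟙-⇔ (mk⇔ ℕ.≤-pred s≤s) (r ℕ.<? suc i) (r ℕ.≤? i)) ⟩
    ι * (k * (𝟙 (r ℕ.≤? i) * (𝟙 (above? (i ∸ r) S) * w (suc r))))
      ≡⟨ solve 5 (λ ι k x y v → ι :* (k :* (x :* (y :* v))) := v :* (x :* (y :* (k :* ι)))) refl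
                ι k (𝟙 (r ℕ.≤? i)) (𝟙 (above? (i ∸ r) S)) (w (suc r)) ⟩
    w (suc r) * contribution n i S r ∎

divisorCoefficient : ∀ n r → r < n →
  ∑[ i < n ] ∑[ S ∈ sublists (downFrom1 i) ] contribution n i S r ≡ 𝟙 (suc r ∣? n)
divisorCoefficient n r r<n = begin
  ∑[ i < n ] ∑[ S ∈ sublists (downFrom1 i) ] contribution n i S r
    ≡⟨ ∑<-cong n (λ {i} _ → ∑∈-distribˡ (𝟙 (r ℕ.≤? i)) (λ S → 𝟙 (above? (i ∸ r) S) * G i S) (sublists (downFrom1 i))) ⟩
  ∑[ i < n ] 𝟙 (r ℕ.≤? i) * F i
    ≡⟨ cong (λ z → ∑[ i < z ] 𝟙 (r ℕ.≤? i) * F i) (sym (ℕ.m+[n∸m]≡n (ℕ.<⇒≤ r<n))) ⟩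
  ∑[ i < r ℕ.+ (n ∸ r) ] 𝟙 (r ℕ.≤? i) * F i
    ≡⟨ ∑<-restrict-≥ r (n ∸ r) F ⟩
  ∑[ c < n ∸ r ] F (r ℕ.+ c)
    ≡⟨ ∑<-cong (n ∸ r) (λ {c} _ → F-window c) ⟩
  cumulativeCount r (n ∸ r) (+ n ℤ.- + suc r)
    ≡⟨ cong (cumulativeCount r (n ∸ r)) (trans (ℤ.m-n≡m⊖n n (suc r)) (ℤ.⊖-≥ r<n)) ⟩
  cumulativeCount r (n ∸ r) (+ (n ∸ suc r))
    ≡⟨ cumulativeCount-divisor r (n ∸ r) (n ∸ suc r) (ℕ.∸-monoʳ-< (ℕ.n<1+n r) r<n) ⟩
  𝟙 (suc r ∣? n ∸ suc r)
    ≡⟨ 𝟙-⇔ (mk⇔ (λ d∣n∸d → ∣m∸n∣n⇒∣m (suc r) r<n d∣n∸d ∣-refl)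
                (λ d∣n → ∣m+n∣m⇒∣n (subst (suc r ∣_) (sym (ℕ.m+[n∸m]≡n r<n)) d∣n) ∣-refl))
           (suc r ∣? n ∸ suc r) (suc r ∣? n) ⟩
  𝟙 (suc r ∣? n) ∎
  where
  open ≡-Reasoning
  G : ℕ → List ℕ → ℚ
  G i S = sign (length S) * 𝟙 (suc i ℕ.+ sum S ℕ.≟ n)
  F : ℕ → ℚ
  F i = ∑[ S ∈ sublists (downFrom1 i) ] 𝟙 (above? (i ∸ r) S) * G i S
  G-shift : ∀ c S → G (r ℕ.+ c) S ≡ sign (length S) * 𝟙 (+ sum S ℤ.≟ (+ n ℤ.- + suc r) ℤ.- + c)
  G-shift c S = cong (_*_ (sign (length S)))
    (𝟙-⇔ (mk⇔ to from) (suc (r ℕ.+ c) ℕ.+ sum S ℕ.≟ n) (+ sum S ℤ.≟ (+ n ℤ.- + suc r) ℤ.- + c))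
    where
    open Equivalence (+≡⇔≡- (+ suc (r ℕ.+ c)) (+ sum S) (+ n)) renaming (to to to′; from to from′)
    regroup : + n ℤ.- + suc (r ℕ.+ c) ≡ (+ n ℤ.- + suc r) ℤ.- + c
    regroup = sym (i-j-k≡i-[j+k] (+ n) (+ suc r) (+ c))
    to : suc (r ℕ.+ c) ℕ.+ sum S ≡ n → + sum S ≡ (+ n ℤ.- + suc r) ℤ.- + c
    to e = trans (to′ (cong +_ e)) regroup
    from : + sum S ≡ (+ n ℤ.- + suc r) ℤ.- + c → suc (r ℕ.+ c) ℕ.+ sum S ≡ n
    from e = ℤ.+-injective (from′ (trans e (sym regroup)))
  F-window : ∀ c → F (r ℕ.+ c) ≡ windowCount r c ((+ n ℤ.- + suc r) ℤ.- + c)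
  F-window c = begin
    F (r ℕ.+ c)
      ≡⟨ cong (λ t → ∑[ S ∈ sublists (downFrom1 (r ℕ.+ c)) ] 𝟙 (above? t S) * G (r ℕ.+ c) S) (ℕ.m+n∸m≡n r c) ⟩
    ∑[ S ∈ sublists (downFrom1 (r ℕ.+ c)) ] 𝟙 (above? c S) * G (r ℕ.+ c) S
      ≡⟨ ∑∈-sublists-window (G (r ℕ.+ c)) c r ⟩
    ∑∈ (G (r ℕ.+ c)) (sublists (window c r))
      ≡⟨ ∑∈-cong (sublists (window c r)) (G-shift c) ⟩
    windowCount r c ((+ n ℤ.- + suc r) ℤ.- + c) ∎

∑∈-𝒟 : ∀ (F : List ℕ → ℚ) n .{{_ : NonZero n}} →
  ∑∈ F (𝒟 n) ≡ ∑[ i < n ] ∑[ S ∈ sublists (downFrom1 i) ] 𝟙 (suc i ℕ.+ sum S ℕ.≟ n) * F (suc i ∷ S)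
∑∈-𝒟 F n = begin
  ∑∈ F (𝒟 n)
    ≡⟨ ∑∈-filter (λ π → sum π ℕ.≟ n) F (sublists (downFrom1 n)) ⟩
  ∑[ π ∈ sublists (downFrom1 n) ] 𝟙 (sum π ℕ.≟ n) * F π
    ≡⟨ ∑∈-sublists-downFrom1 _ n ⟩
  𝟙 (0 ℕ.≟ n) * F [] + ∑< n T
    ≡⟨ cong (_+ ∑< n T) (𝟙-no-* (0 ℕ.≟ n) (λ 0≡n → ℕ.≢-nonZero⁻¹ n (sym 0≡n)) (F [])) ⟩
  0ℚ + ∑< n T
    ≡⟨ ℚ.+-identityˡ _ ⟩
  ∑< n T ∎
  where
  open ≡-Reasoning
  T : ℕ → ℚ
  T i = ∑[ S ∈ sublists (downFrom1 i) ] 𝟙 (suc i ℕ.+ sum S ℕ.≟ n) * F (suc i ∷ S)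

∑∈-divisors : ∀ (f : ℕ → ℚ) n → ∑∈ f (divisors n) ≡ ∑[ r < n ] f (suc r) * 𝟙 (suc r ∣? n)
∑∈-divisors f n = begin
  ∑∈ f (divisors n)                              ≡⟨ ∑∈-filter (_∣? n) f (applyUpTo suc n) ⟩
  ∑[ d ∈ applyUpTo suc n ] 𝟙 (d ∣? n) * f d      ≡⟨ cong sumℚ (List.map-applyUpTo suc _ n) ⟩
  sumℚ (applyUpTo (λ r → 𝟙 (suc r ∣? n) * f (suc r)) n) ≡⟨ sumℚ-applyUpTo _ n ⟩
  ∑[ r < n ] 𝟙 (suc r ∣? n) * f (suc r)          ≡⟨ ∑<-cong n (λ {r} _ → ℚ.*-comm (𝟙 (suc r ∣? n)) (f (suc r))) ⟩
  ∑[ r < n ] f (suc r) * 𝟙 (suc r ∣? n)          ∎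
  where open ≡-Reasoning

corollary2p5 : (m : ℤ) (n : ℕ) → .{{_ : NonZero n}} →
    sumℚ (map (lhsTerm m) (𝒟 n)) ≡ sumℚ (map (rhsTerm m) (divisors n))
corollary2p5 m n = begin
  ∑∈ (lhsTerm m) (𝒟 n)
    ≡⟨ ∑∈-𝒟 (lhsTerm m) n ⟩
  ∑[ i < n ] ∑[ S ∈ sublists (downFrom1 i) ] 𝟙 (suc i ℕ.+ sum S ℕ.≟ n) * lhsTerm m (suc i ∷ S)
    ≡⟨ ∑<-cong n (λ {i} i<n → ∑∈-congᴬ (sublists-downFrom1-descending i (suc i) ℕ.≤-refl) (lhsTerm-expand m n i _ i<n)) ⟩
  ∑[ i < n ] ∑[ S ∈ sublists (downFrom1 i) ] ∑[ r < n ] rhsTerm m (suc r) * contribution n i S r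
    ≡⟨ ∑<-∑∈-∑<-factor n (λ i → sublists (downFrom1 i)) n (λ r → rhsTerm m (suc r)) (contribution n) ⟩
  ∑[ r < n ] rhsTerm m (suc r) * (∑[ i < n ] ∑[ S ∈ sublists (downFrom1 i) ] contribution n i S r)
    ≡⟨ ∑<-cong n (λ {r} r<n → cong (rhsTerm m (suc r) *_) (divisorCoefficient n r r<n)) ⟩
  ∑[ r < n ] rhsTerm m (suc r) * 𝟙 (suc r ∣? n)
    ≡⟨ sym (∑∈-divisors (rhsTerm m) n) ⟩
  ∑∈ (rhsTerm m) (divisors n) ∎
  where open ≡-Reasoning
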